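{- Let $n_1,\dots,n_b\ge 2$ and $m\ge1$ be integers, and let $A$ be the ring $\mathbb{Z}_{n_1}\oplus\cdots\oplus\mathbb{Z}_{n_b}$. Then $$\mathsf{D}_m(A)\ge\sum_{j=1}^b L(n_j,m)-(b-1)m.$$
   Context: For a finite commutative ring $A$, a sequence over $A$ is a finite multiset of elements of $A$; its length counts multiplicity, and a subsequence is a sub-multiset. For $S=(a_1,\dots,a_\ell)$ and $m\ge1$, $e_m(S)=\sum_{1\le i_1<\dots<i_m\le \ell}\prod_{j=1}^m a_{i_j}$. $\mathsf{D}_m(A)$ is the smallest positive integer $t$ such that every sequence $S$ over $A$ with $|S|\ge t$ contains a subsequence $S'$ with $|S'|\ge m$ and $e_m(S')=0$. Ring operations on the direct product are componentwise. For integers $n,m\ge1$, $L(n,m)$ is the smallest integer $t\ge m+1$ such that $\binom{t}{m}\equiv0\pmod n$. -}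

module Defs where

open import Data.Nat using (ℕ; zero; suc; _+_; _*_; _≤_; _<_)
open import Data.Nat.Divisibility using (_∣_)
open import Data.Nat.Combinatorics using (_C_)
open import Data.Fin using (Fin; toℕ)
import Data.Fin as F
open import Data.List using (List; []; _∷_; map; length)
open import Data.List.Relation.Binary.Sublist.Propositional using (_⊆_)
open import Data.Product using (Σ; _×_)

∑ : (b : ℕ) → (Fin b → ℕ) → ℕ
∑ zero    f = 0
∑ (suc b) f = f F.zero + ∑ b (λ j → f (F.suc j))

e : ℕ → List ℕ → ℕ
e zero    xs       = 1
e (suc m) []       = 0
e (suc m) (x ∷ xs) = x * e m xs + e (suc m) xs

-- The ring A = ℤ_{n_1} ⊕ ... ⊕ ℤ_{n_b}: an element is a tuple of residues,
-- component j being an element of Fin (n j) ≅ ℤ_{n j}.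
Elt : (b : ℕ) → (Fin b → ℕ) → Set
Elt b n = (j : Fin b) → Fin (n j)

-- e_m(S) = 0 in A: operations are componentwise, and since e_m is an integer
-- polynomial, the j-th component of e_m(S) in ℤ_{n j} is the residue of the
-- integer e_m of the representatives; it vanishes iff n j divides it.
eZero : (b : ℕ) (n : Fin b → ℕ) → ℕ → List (Elt b n) → Set
eZero b n m S = (j : Fin b) → n j ∣ e m (map (λ a → toℕ (a j)) S)

-- The defining property of D_m(A) for a candidate t: every sequence S over A
-- with |S| ≥ t has a subsequence S' with |S'| ≥ m and e_m(S') = 0.
-- (Sequences are lists; sub-multisets are sublists up to reordering, and e_m
-- is symmetric, so order-preserving sublists suffice.)
DProp : (b : ℕ) (n : Fin b → ℕ) → ℕ → ℕ → Set
DProp b n m t = (S : List (Elt b n)) → t ≤ length S →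
  Σ (List (Elt b n)) (λ S' → S' ⊆ S × (m ≤ length S' × eZero b n m S'))

IsD : (b : ℕ) (n : Fin b → ℕ) → ℕ → ℕ → Set
IsD b n m t = (1 ≤ t × DProp b n m t) × ((s : ℕ) → 1 ≤ s → DProp b n m s → t ≤ s)

IsL : ℕ → ℕ → ℕ → Set
IsL n m t = (suc m ≤ t × n ∣ (t C m)) × ((s : ℕ) → suc m ≤ s → n ∣ (s C m) → t ≤ s)

{-# OPTIONS --safe #-}
module Submission where

-- Write Lⱼ = L(nⱼ,m) and let eᵢ be the element whose components j < i are 0
-- and j ≥ i are 1. The sequence with m − 1 copies of e₀ followed by Lᵢ − m
-- copies of each eᵢ (i = 0, …, b) has length ∑ Lⱼ − bm − 1, and no subsequence
-- T of length ≥ m has e_m(T) = 0: component j of T is a 0/1 vector with kⱼ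
-- ones (kⱼ = number of terms from blocks ≤ j), so e_m(T)ⱼ = C(kⱼ,m). At the
-- first j with kⱼ ≥ m we have
-- m ≤ kⱼ ≤ (m − 1) + (Lⱼ − m) < Lⱼ, and minimality of Lⱼ gives nⱼ ∤ C(kⱼ,m).

open import Defs
open import Data.Nat using (ℕ; zero; suc; _+_; _*_; _∸_; _≤_; _<_; z≤n; s≤s; _≤?_; _≟_)
open import Data.Nat.Properties
open import Algebra.Properties.CommutativeSemigroup +-commutativeSemigroup using (interchange)
open import Data.Nat.Divisibility using (_∣_; ∣1⇒≡1)
open import Data.Nat.Combinatorics using (_C_; nCn≡1; nCk+nC[k+1]≡[n+1]C[k+1])
open import Data.Fin using (Fin; toℕ; fromℕ<)
import Data.Fin as F
open import Data.Fin.Properties using (toℕ-fromℕ<)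
open import Data.List using (List; []; _∷_; map; length; replicate; _++_)
open import Data.List.Properties using (length-replicate; length-map; ++-assoc; ++-identityʳ)
open import Data.List.Relation.Binary.Sublist.Propositional using (_⊆_; []; _∷_; _∷ʳ_; ⊆-refl)
open import Data.List.Relation.Binary.Sublist.Propositional.Properties using (++⁺; length-mono-≤)
open import Data.Product using (∃; _×_; _,_; proj₁)
open import Data.Nat.Tactic.RingSolver using (solve-∀)
open import Function using (_∘_)
open import Relation.Nullary using (yes; no; ¬_; contradiction)
open import Relation.Binary.PropositionalEquality

private
  variable
    A B : Set

replicate-++ : ∀ s t (x : A) → replicate s x ++ replicate t x ≡ replicate (s + t) x
replicate-++ zero    t x = refl
replicate-++ (suc s) t x = cong (x ∷_) (replicate-++ s t x)

length-replicate-++ : ∀ k (x : A) xs → length (replicate k x ++ xs) ≡ k + length xs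
length-replicate-++ zero    x xs = refl
length-replicate-++ (suc k) x xs = cong suc (length-replicate-++ k x xs)

⊆-replicate-++⁻ : ∀ c (x : A) {xs ys} → ys ⊆ replicate c x ++ xs →
  ∃ λ k → k ≤ c × ∃ λ zs → ys ≡ replicate k x ++ zs × zs ⊆ xs
⊆-replicate-++⁻ zero    x ys⊆ = 0 , z≤n , _ , refl , ys⊆
⊆-replicate-++⁻ (suc c) x (.x ∷ʳ ys⊆) with ⊆-replicate-++⁻ c x ys⊆
... | k , k≤c , zs , refl , zs⊆ = k , m≤n⇒m≤1+n k≤c , zs , refl , zs⊆
⊆-replicate-++⁻ (suc c) x (refl ∷ ys⊆) with ⊆-replicate-++⁻ c x ys⊆
... | k , k≤c , zs , refl , zs⊆ = suc k , s≤s k≤c , zs , refl , zs⊆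

⊆-map⁻ : ∀ (f : A → B) xs {ys} → ys ⊆ map f xs → ∃ λ zs → ys ≡ map f zs × zs ⊆ xs
⊆-map⁻ f []       []            = [] , refl , []
⊆-map⁻ f (x ∷ xs) (.(f x) ∷ʳ ys⊆) with ⊆-map⁻ f xs ys⊆
... | zs , refl , zs⊆ = zs , refl , x ∷ʳ zs⊆
⊆-map⁻ f (x ∷ xs) (refl ∷ ys⊆)   with ⊆-map⁻ f xs ys⊆
... | zs , refl , zs⊆ = x ∷ zs , refl , refl ∷ zs⊆

e-ones++zeros : ∀ m k r → e m (replicate k 1 ++ replicate r 0) ≡ k C m
e-ones++zeros zero    k       r       = refl
e-ones++zeros (suc m) zero    zero    = refl
e-ones++zeros (suc m) zero    (suc r) = e-ones++zeros (suc m) zero r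
e-ones++zeros (suc m) (suc k) r       = begin
  1 * e m xs + e (suc m) xs  ≡⟨ cong₂ _+_ (*-identityˡ _) (e-ones++zeros (suc m) k r) ⟩
  e m xs + k C suc m         ≡⟨ cong (_+ k C suc m) (e-ones++zeros m k r) ⟩
  k C m + k C suc m          ≡⟨ nCk+nC[k+1]≡[n+1]C[k+1] k m ⟩
  suc k C suc m              ∎
  where
  open ≡-Reasoning
  xs : List ℕ
  xs = replicate k 1 ++ replicate r 0

∤C-below-L : ∀ {n m L k} → 2 ≤ n → IsL n m L → m ≤ k → k < L → ¬ n ∣ k C m
∤C-below-L {n} {m} {k = k} 2≤n (_ , minimal) m≤k k<L n∣kCm with m ≟ k
... | yes refl = contradiction (subst (2 ≤_) (∣1⇒≡1 (subst (n ∣_) (nCn≡1 m) n∣kCm)) 2≤n)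
                               λ { (s≤s ()) }
... | no m≢k   = <⇒≱ k<L (minimal _ (≤∧≢⇒< m≤k m≢k) n∣kCm)

column : ∀ {b n} → Fin b → List (Elt b n) → List ℕ
column j = map (λ a → toℕ (a j))

eZeroFree : (b : ℕ) (n : Fin b → ℕ) → ℕ → List (Elt b n) → Set
eZeroFree b n m S = ∀ S′ → S′ ⊆ S → m ≤ length S′ → ¬ eZero b n m S′

eZeroFree⇒length< : ∀ {b n m t S} → eZeroFree b n m S → DProp b n m t → length S < t
eZeroFree⇒length< {t = t} {S} free D with t ≤? length S
... | yes t≤∣S∣ = let S′ , S′⊆S , m≤∣S′∣ , zero-e = D S t≤∣S∣ in
                  contradiction zero-e (free S′ S′⊆S m≤∣S′∣)
... | no  t≰∣S∣ = ≰⇒> t≰∣S∣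

𝟙 : ∀ {b} {n : Fin b → ℕ} → (∀ j → 2 ≤ n j) → Elt b n
𝟙 2≤n j = fromℕ< (2≤n j)

module _ {b : ℕ} {n : Fin (suc b) → ℕ} (2≤n : ∀ j → 2 ≤ n j) where

  zero-extend : Elt b (n ∘ F.suc) → Elt (suc b) n
  zero-extend a F.zero    = fromℕ< (≤-trans (s≤s z≤n) (2≤n F.zero))
  zero-extend a (F.suc j) = a j

  column-zero : ∀ k T → column F.zero (replicate k (𝟙 2≤n) ++ map zero-extend T)
                          ≡ replicate k 1 ++ replicate (length T) 0
  column-zero (suc k) T       = cong₂ _∷_ (toℕ-fromℕ< (2≤n F.zero)) (column-zero k T)
  column-zero zero    []      = refl
  column-zero zero    (a ∷ T) = cong₂ _∷_ (toℕ-fromℕ< _) (column-zero zero T)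

  column-suc : ∀ j k T → column (F.suc j) (replicate k (𝟙 2≤n) ++ map zero-extend T)
                           ≡ column j (replicate k (𝟙 (2≤n ∘ F.suc)) ++ T)
  column-suc j (suc k) T       = cong (_ ∷_) (column-suc j k T)
  column-suc j zero    []      = refl
  column-suc j zero    (a ∷ T) = cong (_ ∷_) (column-suc j zero T)

staircase : ∀ {b} {n : Fin b → ℕ} → (∀ j → 2 ≤ n j) → (Fin b → ℕ) → List (Elt b n)
staircase {zero}  2≤n c = []
staircase {suc b} 2≤n c = replicate (c F.zero) (𝟙 2≤n)
                       ++ map (zero-extend 2≤n) (staircase (2≤n ∘ F.suc) (c ∘ F.suc))

length-staircase : ∀ {b} {n : Fin b → ℕ} (2≤n : ∀ j → 2 ≤ n j) c → length (staircase 2≤n c) ≡ ∑ b c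
length-staircase {zero}  2≤n c = refl
length-staircase {suc b} {n} 2≤n c = begin
  length (replicate (c F.zero) _ ++ map _ rest)  ≡⟨ length-replicate-++ (c F.zero) _ _ ⟩
  c F.zero + length (map _ rest)                 ≡⟨ cong (c F.zero +_) (length-map _ rest) ⟩
  c F.zero + length rest
    ≡⟨ cong (c F.zero +_) (length-staircase (2≤n ∘ F.suc) (c ∘ F.suc)) ⟩
  ∑ (suc b) c                                    ∎
  where
  open ≡-Reasoning
  rest : List (Elt b (n ∘ F.suc))
  rest = staircase (2≤n ∘ F.suc) (c ∘ F.suc)

-- The s leading copies of 𝟙 stand for the terms taken from earlier blocks, which
-- become copies of 𝟙 once the leading components are dropped.
staircase-eZeroFree : ∀ {b} {n : Fin b → ℕ} {m} (2≤n : ∀ j → 2 ≤ n j) {L c : Fin b → ℕ} →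
  (∀ j → IsL (n j) m (L j)) → (∀ j → c j + m ≤ L j) →
  ∀ {s} → s < m → eZeroFree b n m (replicate s (𝟙 2≤n) ++ staircase 2≤n c)
staircase-eZeroFree {zero} {m = m} 2≤n _ _ {s} s<m T T⊆ m≤∣T∣ _ = <⇒≱ s<m (begin
  m                              ≤⟨ m≤∣T∣ ⟩
  length T                       ≤⟨ length-mono-≤ T⊆ ⟩
  length (replicate s _ ++ [])   ≡⟨ cong length (++-identityʳ (replicate s _)) ⟩
  length (replicate s _)         ≡⟨ length-replicate s ⟩
  s                              ∎)
  where open ≤-Reasoning
staircase-eZeroFree {suc b} {n} {m} 2≤n {L} {c} isL c+m≤L {s} s<m T T⊆ m≤∣T∣ zero-e
  with ⊆-replicate-++⁻ (s + c F.zero) (𝟙 2≤n) (subst (T ⊆_) merge-blocks T⊆)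
  where
  merge-blocks : replicate s (𝟙 2≤n) ++ staircase 2≤n c
               ≡ replicate (s + c F.zero) (𝟙 2≤n)
                   ++ map (zero-extend 2≤n) (staircase (2≤n ∘ F.suc) (c ∘ F.suc))
  merge-blocks = trans (sym (++-assoc (replicate s _) _ _))
                       (cong (_++ _) (replicate-++ s (c F.zero) _))
... | k , k≤s+c₀ , _ , refl , T′⊆ with ⊆-map⁻ (zero-extend 2≤n) _ T′⊆
... | T₀ , refl , T₀⊆ with m ≤? k
... | yes m≤k = ∤C-below-L (2≤n F.zero) (isL F.zero) m≤k k<L₀
                  (subst (n F.zero ∣_) e-column-zero (zero-e F.zero))
  where
  e-column-zero : e m (column F.zero (replicate k (𝟙 2≤n) ++ map (zero-extend 2≤n) T₀)) ≡ k C m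
  e-column-zero = trans (cong (e m) (column-zero 2≤n k T₀)) (e-ones++zeros m k _)
  k<L₀ : k < L F.zero
  k<L₀ = begin-strict
    k             ≤⟨ k≤s+c₀ ⟩
    s + c F.zero  <⟨ +-monoˡ-< (c F.zero) s<m ⟩
    m + c F.zero  ≡⟨ +-comm m (c F.zero) ⟩
    c F.zero + m  ≤⟨ c+m≤L F.zero ⟩
    L F.zero      ∎
    where open ≤-Reasoning
... | no  m≰k = staircase-eZeroFree (2≤n ∘ F.suc) (isL ∘ F.suc) (c+m≤L ∘ F.suc) (≰⇒> m≰k)
                  (replicate k _ ++ T₀) (++⁺ ⊆-refl T₀⊆) (≤-trans m≤∣T∣ (≤-reflexive same-length))
                  (λ j → subst (n (F.suc j) ∣_) (cong (e m) (column-suc 2≤n j k T₀)) (zero-e (F.suc j)))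
  where
  same-length : length (replicate k (𝟙 2≤n) ++ map (zero-extend 2≤n) T₀)
              ≡ length (replicate k (𝟙 (2≤n ∘ F.suc)) ++ T₀)
  same-length = begin
    length (replicate k _ ++ map (zero-extend 2≤n) T₀)  ≡⟨ length-replicate-++ k _ _ ⟩
    k + length (map (zero-extend 2≤n) T₀)               ≡⟨ cong (k +_) (length-map _ T₀) ⟩
    k + length T₀                                       ≡⟨ length-replicate-++ k _ T₀ ⟨
    length (replicate k _ ++ T₀)                        ∎
    where open ≡-Reasoning

∑-∸+* : ∀ b (f : Fin b → ℕ) m → (∀ j → m ≤ f j) → ∑ b (λ j → f j ∸ m) + b * m ≡ ∑ b f
∑-∸+* zero    f m m≤f = refl
∑-∸+* (suc b) f m m≤f = begin
  (f F.zero ∸ m + ∑ b (λ j → f (F.suc j) ∸ m)) + (m + b * m)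
    ≡⟨ interchange (f F.zero ∸ m) (∑ b (λ j → f (F.suc j) ∸ m)) m (b * m) ⟩
  (f F.zero ∸ m + m) + (∑ b (λ j → f (F.suc j) ∸ m) + b * m)
    ≡⟨ cong₂ _+_ (m∸n+n≡m (m≤f F.zero)) (∑-∸+* b (f ∘ F.suc) m (m≤f ∘ F.suc)) ⟩
  f F.zero + ∑ b (f ∘ F.suc)                                   ∎
  where open ≡-Reasoning

theorem12 : (b : ℕ) (n : Fin (suc b) → ℕ) (m : ℕ) →
    ((j : Fin (suc b)) → 2 ≤ n j) → 1 ≤ m →
    (Lv : Fin (suc b) → ℕ) → ((j : Fin (suc b)) → IsL (n j) m (Lv j)) →
    (d : ℕ) → IsD (suc b) n m d →
    ∑ (suc b) Lv ≤ d + b * m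
theorem12 b n zero    2≤n ()
theorem12 b n (suc k) 2≤n _ L isL d ((_ , D) , _) = begin
  ∑ (suc b) L                              ≡⟨ ∑-∸+* (suc b) L (suc k) m≤L ⟨
  ∑ (suc b) c + suc b * suc k              ≡⟨ rearrange k (∑ (suc b) c) (b * suc k) ⟩
  suc (k + ∑ (suc b) c) + b * suc k        ≡⟨ cong (λ l → suc l + b * suc k) ∣S∣ ⟨
  suc (length S) + b * suc k               ≤⟨ +-monoˡ-≤ (b * suc k) (eZeroFree⇒length< S-free D) ⟩
  d + b * suc k                            ∎
  where
  open ≤-Reasoning
  m≤L : ∀ j → suc k ≤ L j
  m≤L j = <⇒≤ (proj₁ (proj₁ (isL j)))
  c : Fin (suc b) → ℕ
  c j = L j ∸ suc k
  S : List (Elt (suc b) n)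
  S = replicate k (𝟙 2≤n) ++ staircase 2≤n c
  S-free : eZeroFree (suc b) n (suc k) S
  S-free = staircase-eZeroFree 2≤n isL (λ j → ≤-reflexive (m∸n+n≡m (m≤L j))) ≤-refl
  ∣S∣ : length S ≡ k + ∑ (suc b) c
  ∣S∣ = trans (length-replicate-++ k _ _) (cong (k +_) (length-staircase 2≤n c))
  rearrange : ∀ k x y → x + (suc k + y) ≡ suc (k + x) + y
  rearrange = solve-∀
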